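{- Let $T\subseteq\mathbb{N}^{<\mathbb{N}}$ be a tree. The map $h:T\to\omega^{\mathcal{JT}(T)}$ is $(\supset,<_{\omega^{\mathcal{JT}(T)}})$-monotone: for $\rho,\sigma\in T$ with $\rho\supsetneq\sigma$, $h(\rho)<_{\omega^{\mathcal{JT}(T)}}h(\sigma)$.
   Context: Strings are coded by numbers with $\sigma\subset\tau\Rightarrow\sigma<\tau$. $\{e\}^\sigma(n)\downarrow$ means the $e$-th oracle machine with oracle $\sigma$ halts on $n$ within $|\sigma|$ steps ($\uparrow$ otherwise). Jump function on strings: for $\sigma$, $t_{ -1}=1$, $t_n=\max\{t_{n-1}+1,\mu t(\{n\}^{\sigma\restriction t}(n)\downarrow)\}$ (or $t_{n-1}+1$ if no such $t$), $J(\sigma)=\langle\sigma\restriction t_0,\dots,\sigma\restriction t_{k-1}\rangle$ with $k$ least such that $t_k>|\sigma|$. $\mathcal{JT}(T)=\{J(\sigma):\sigma\in T\}$, ordered by the Kleene–Brouwer order $\leq_{KB}$: $\sigma\leq_{KB}\tau$ iff $\sigma\supseteq\tau$ or there is $i$ with $\sigma\restriction i=\tau\restriction i$ and $\sigma(i)<\tau(i)$. For a linear ordering $\mathcal{X}$, $\omega^{\mathcal{X}}$ consists of finite nonincreasing strings from $\mathcal{X}$ (written as sums $\omega^{x_0}+\dots+\omega^{x_{k-1}}$ with $x_0\geq\dots\geq x_{k-1}$) ordered lexicographically (proper initial segments smaller). Define $h(\emptyset)=\omega^{\emptyset}\cdot 3$ and, for $\sigma\neq\emptyset$, $h(\sigma)=\left(\sum_{i<|J(\sigma)|,\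 \{i\}^\sigma(i)\uparrow}\omega^{J(\sigma)\restriction i}\right)+\omega^{J(\sigma)}\cdot 2$, the sum taken in increasing order of $i$ (which is $\leq_{KB}$-decreasing order of exponents). -}

module Defs where

open import Data.Nat using (ℕ; zero; suc; _+_; _<_; _≤ᵇ_; _⊔_)
open import Data.Bool using (Bool; true; false; if_then_else_; not)
open import Data.List using (List; []; _∷_; _++_; take; length; map; filter; upTo)
open import Data.Maybe using (Maybe; just; nothing)
open import Data.Product using (Σ; ∃; _×_; _,_)
open import Data.Empty using (⊥)
open import Relation.Binary.PropositionalEquality using (_≡_)
open import Relation.Nullary using (¬_)
open import Data.Bool.Properties using (T?)
open import Data.List.Relation.Binary.Lex.Strict using (Lex-<)
open import Function.Definitions using (Injective)

Str : Set
Str = List ℕ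

_⊂_ : {A : Set} → List A → List A → Set
σ ⊂ τ = Σ _ λ x → Σ _ λ δ → τ ≡ σ ++ (x ∷ δ)

IsTree : (Str → Set) → Set
IsTree T = ∀ σ τ → T (σ ++ τ) → T σ

IsCoding : (Str → ℕ) → Set
IsCoding code = Injective _≡_ _≡_ code × (∀ σ τ → σ ⊂ τ → code σ < code τ)

-- Abstract oracle-machine halting:  halts e σ n ≡ true  means
-- {e}^σ(n)↓, i.e. the e-th oracle machine with oracle σ halts on n
-- within |σ| steps.  Properties of the (standard) machine model used:
-- it is monotone in the oracle and nothing halts within 0 steps.
IsHalting : (ℕ → Str → ℕ → Bool) → Set
IsHalting halts =
  (∀ e σ τ n → σ ⊂ τ → halts e σ n ≡ true → halts e τ n ≡ true)
  × (∀ e n → halts e [] n ≡ false)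

data KB< {A : Set} (_≺_ : A → A → Set) : List A → List A → Set where
  ext  : ∀ σ τ → τ ⊂ σ → KB< _≺_ σ τ
  diff : ∀ π a b r s → a ≺ b → KB< _≺_ (π ++ a ∷ r) (π ++ b ∷ s)

module Jump (halts : ℕ → Str → ℕ → Bool) where

  search : (ℕ → Bool) → (start fuel : ℕ) → Maybe ℕ
  search p s zero = if p s then just s else nothing
  search p s (suc f) = if p s then just s else search p (suc s) f

  -- μ t ({n}^{σ↾t}(n)↓); since σ↾t = σ for t ≥ |σ|, searching t ≤ |σ| suffices.
  μhalt : Str → ℕ → Maybe ℕ
  μhalt σ n = search (λ t → halts n (take t σ) n) 0 (length σ)

  next : Str → ℕ → ℕ → ℕ
  next σ n prev with μhalt σ n
  ... | just t  = suc prev ⊔ t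
  ... | nothing = suc prev

  -- components σ↾t_n for n ≥ start while t_n ≤ |σ|
  -- (fuel |σ| suffices since t_n ≥ n + 2)
  go : Str → (fuel n prev : ℕ) → List Str
  go σ zero n prev = []
  go σ (suc f) n prev =
    if next σ n prev ≤ᵇ length σ
    then take (next σ n prev) σ ∷ go σ f (suc n) (next σ n prev)
    else []

  J : Str → List Str
  J σ = go σ (length σ) 0 1

  _<JT[_]_ : List Str → (Str → ℕ) → List Str → Set
  X <JT[ code ] Y = KB< (λ a b → code a < code b) X Y

  -- ω^X : finite nonincreasing sequences of exponents, ordered
  -- lexicographically with proper initial segments smaller.
  _<ω[_]_ : List (List Str) → (Str → ℕ) → List (List Str) → Set
  a <ω[ code ] b = Lex-< _≡_ (λ x y → x <JT[ code ] y) a b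

  -- h(σ), written as the list of exponents of the sum of ω-powers
  h : Str → List (List Str)
  h [] = [] ∷ [] ∷ [] ∷ []
  h σ@(_ ∷ _) =
    map (λ i → take i (J σ)) (filter (λ i → T? (not (halts i σ i))) (upTo (length (J σ))))
    ++ (J σ ∷ J σ ∷ [])

-- Write N_σ(i) for "{i}^σ(i)↑".  For σ ≠ ∅, h(σ) lists the prefixes J(σ)↾i at
-- the indices i with N_σ(i), followed by J(σ) twice.
--
-- Combinatorial part (hList, Overtakes, module KBOrder; arbitrary flags and any
-- order ≺ on components): say Y overtakes X if Y = π ++ y ∷ Yr and X = π ++ Xr
-- where either Xr = [] or the flags switch from N_X = true to N_Y = false at
-- position |π|.  If moreover N_Y ⊆ N_X, then hList N_Y Y < hList N_X X
-- (hList-overtaken): the lists agree until the list for Y shows a *proper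
-- extension* of the current prefix, and a proper extension is KB-smaller.
--
-- Computational part (module Halting): for S ⊊ R, halting is monotone in the
-- oracle, so the sequences t_n of S and R agree until either J(S) ends or some
-- {n}^S(n)↑ while {n}^R(n)↓, and J(R) continues past the common part; that is,
-- J(R) overtakes J(S) (jump-overtakes).
module Submission where

open import Defs
open import Data.Nat using (ℕ; zero; suc; _+_; _<_; _≤_; _≤ᵇ_; _≤?_; _⊔_; z≤n; s≤s)
open import Data.Nat.Properties
open import Data.Bool using (Bool; true; false; not)
open import Data.Bool.Properties using (T?; T-≡)
open import Data.List using (List; []; _∷_; _++_; [_]; take; drop; length; map; filter; applyUpTo)
open import Data.List.Properties using (++-assoc; ++-identityʳ; length-++; take-all; take++drop≡id)
open import Data.List.Relation.Binary.Lex.Strict using (Lex-<)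
open import Data.List.Relation.Binary.Lex.Core using (this; next; halt)
open import Data.Maybe using (just; nothing)
open import Data.Maybe.Properties using (just-injective)
open import Data.Product using (∃; ∃₂; _×_; _,_; proj₁; proj₂)
open import Data.Sum using (_⊎_; inj₁; inj₂; map₂)
open import Data.Empty using (⊥-elim)
open import Function using (_∘_)
open import Function.Bundles using (Equivalence)
open import Relation.Nullary using (yes; no)
open import Relation.Binary.PropositionalEquality
  using (_≡_; refl; sym; trans; cong; cong₂; subst)

cons? : {A : Set} → Bool → A → List A → List A
cons? true  a l = a ∷ l
cons? false a l = l

take-++-≤ : ∀ {A : Set} t (σ δ : List A) → t ≤ length σ → take t (σ ++ δ) ≡ take t σ
take-++-≤ zero    σ       δ _         = refl
take-++-≤ (suc t) (a ∷ σ) δ (s≤s t≤σ) = cong (a ∷_) (take-++-≤ t σ δ t≤σ)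

take-length-++ : ∀ {A : Set} (σ δ : List A) → take (length σ) (σ ++ δ) ≡ σ
take-length-++ σ δ = trans (take-++-≤ (length σ) σ δ ≤-refl) (take-all (length σ) σ ≤-refl)

module _ {A : Set} where

  -- hList N pre rest: the exponents of h for the component list pre ++ rest,
  -- starting at index |pre|, with N giving the flags relative to that index.
  hList : (ℕ → Bool) → List A → List A → List (List A)
  hList N pre []         = pre ∷ pre ∷ []
  hList N pre (x ∷ rest) = cons? (N 0) pre (hList (N ∘ suc) (pre ++ [ x ]) rest)

  hList-head : ∀ N pre rest → ∃₂ λ δ tl → hList N pre rest ≡ (pre ++ δ) ∷ tl
  hList-head N pre [] = [] , pre ∷ [] , cong (_∷ pre ∷ []) (sym (++-identityʳ pre))
  hList-head N pre (x ∷ rest) with N 0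
  ... | true  = [] , _ , cong₂ _∷_ (sym (++-identityʳ pre)) refl
  ... | false with hList-head (N ∘ suc) (pre ++ [ x ]) rest
  ...   | δ , tl , eq = x ∷ δ , tl , trans eq (cong (_∷ tl) (++-assoc pre [ x ] δ))

  hList-flagged : ∀ N pre rest → N 0 ≡ true → ∃ λ tl → hList N pre rest ≡ pre ∷ tl
  hList-flagged N pre []         _ = _ , refl
  hList-flagged N pre (x ∷ rest) _ with N 0
  hList-flagged N pre (x ∷ rest) refl | true = _ , refl

  length-snoc-+ : ∀ (pre : List A) x k → length pre + suc k ≡ length (pre ++ [ x ]) + k
  length-snoc-+ pre x k rewrite length-++ pre {[ x ]} =
    trans (+-suc _ k) (cong (_+ k) (+-comm 1 (length pre)))

  filter-hList : ∀ (N : ℕ → Bool) g pre rest W → W ≡ pre ++ rest →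
                 (∀ k → g k ≡ length pre + k) →
                 map (λ i → take i W) (filter (λ i → T? (N i)) (applyUpTo g (length rest)))
                   ++ W ∷ W ∷ []
                 ≡ hList (N ∘ g) pre rest
  filter-hList N g pre [] W refl _ rewrite ++-identityʳ pre = refl
  filter-hList N g pre (x ∷ rest) W W≡ g≡
    with N (g 0)
       | filter-hList N (g ∘ suc) (pre ++ [ x ]) rest W
           (trans W≡ (sym (++-assoc pre [ x ] rest)))
           (λ k → trans (g≡ (suc k)) (length-snoc-+ pre x k))
  ... | true  | rest-eq = cong₂ _∷_ take-pre rest-eq
    where
      take-pre : take (g 0) W ≡ pre
      take-pre rewrite W≡ | g≡ 0 | +-identityʳ (length pre) = take-length-++ pre (x ∷ rest)
  ... | false | rest-eq = rest-eq

  record Overtakes (NX NY : ℕ → Bool) (X Y : List A) : Set where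
    constructor overtakes
    field
      common : List A
      restX  : List A
      nextY  : A
      restY  : List A
      X≡     : X ≡ common ++ restX
      Y≡     : Y ≡ common ++ nextY ∷ restY
      switch : restX ≡ [] ⊎ (NX (length common) ≡ true × NY (length common) ≡ false)

  overtakes-∷ : ∀ {NX NY NX′ NY′ X Y} a →
                (∀ i → NX′ i ≡ NX (suc i)) → (∀ i → NY′ i ≡ NY (suc i)) →
                Overtakes NX′ NY′ X Y → Overtakes NX NY (a ∷ X) (a ∷ Y)
  overtakes-∷ a shiftX shiftY (overtakes π Xr y Yr X≡ Y≡ sw) =
    overtakes (a ∷ π) Xr y Yr (cong (a ∷_) X≡) (cong (a ∷_) Y≡)
      (map₂ (λ (fX , fY) → trans (sym (shiftX _)) fX , trans (sym (shiftY _)) fY) sw)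

module KBOrder {A : Set} (_≺_ : A → A → Set) where

  _<ω_ : List (List A) → List (List A) → Set
  _<ω_ = Lex-< _≡_ (KB< _≺_)

  extension-below : ∀ N pre y rest tl → hList N (pre ++ [ y ]) rest <ω (pre ∷ tl)
  extension-below N pre y rest tl with hList-head N (pre ++ [ y ]) rest
  ... | δ , _ , eq rewrite eq | ++-assoc pre [ y ] δ = this (ext _ _ (y , δ , refl))

  continuation-below : ∀ N pre y rest tl → hList N pre (y ∷ rest) <ω (pre ∷ pre ∷ tl)
  continuation-below N pre y rest tl with N 0
  ... | true  = next refl (extension-below (N ∘ suc) pre y rest tl)
  ... | false = extension-below (N ∘ suc) pre y rest _

  below-empty : ∀ N Y → hList N [] Y <ω ([] ∷ [] ∷ [] ∷ [])
  below-empty N []      = next refl (next refl halt)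
  below-empty N (y ∷ Y) = continuation-below N [] y Y ([] ∷ [])

  hList-overtaken : ∀ (NX NY : ℕ → Bool) → (∀ j → NY j ≡ true → NX j ≡ true) →
                    ∀ π Xr y Yr pre →
                    (Xr ≡ [] ⊎ (NX (length π) ≡ true × NY (length π) ≡ false)) →
                    hList NY pre (π ++ y ∷ Yr) <ω hList NX pre (π ++ Xr)
  hList-overtaken NX NY NY⊆NX (x ∷ π) Xr y Yr pre sw with NX 0 in eX | NY 0 in eY
  ... | true  | true  = next refl (hList-overtaken (NX ∘ suc) (NY ∘ suc) (NY⊆NX ∘ suc) π Xr y Yr _ sw)
  ... | true  | false = extension-below (NY ∘ suc) pre x (π ++ y ∷ Yr) _
  ... | false | true  with () ← trans (sym eX) (NY⊆NX 0 eY)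
  ... | false | false = hList-overtaken (NX ∘ suc) (NY ∘ suc) (NY⊆NX ∘ suc) π Xr y Yr _ sw
  hList-overtaken NX NY _ [] .[] y Yr pre (inj₁ refl) = continuation-below NY pre y Yr []
  hList-overtaken NX NY _ [] Xr  y Yr pre (inj₂ (flaggedX , unflaggedY))
    with hList-flagged NX pre Xr flaggedX
  ... | _ , eq rewrite eq | unflaggedY = extension-below (NY ∘ suc) pre y Yr _

  overtaken-below : ∀ {NX NY X Y} → (∀ j → NY j ≡ true → NX j ≡ true) →
                    Overtakes NX NY X Y → hList NY [] Y <ω hList NX [] X
  overtaken-below NY⊆NX (overtakes π Xr y Yr refl refl sw) =
    hList-overtaken _ _ NY⊆NX π Xr y Yr [] sw

module Halting (halts : ℕ → Str → ℕ → Bool) (isHalting : IsHalting halts) where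
  open Jump halts renaming (next to nextT)

  halts-mono : ∀ e σ τ n → σ ⊂ τ → halts e σ n ≡ true → halts e τ n ≡ true
  halts-mono = proj₁ isHalting

  halts-take : ∀ e t σ n → halts e (take t σ) n ≡ true → halts e σ n ≡ true
  halts-take e t σ n h with drop t σ | take++drop≡id t σ
  ... | []    | eq = subst (λ τ → halts e τ n ≡ true) (trans (sym (++-identityʳ _)) eq) h
  ... | y ∷ d | eq = halts-mono e (take t σ) σ n (y , d , sym eq) h

  flags : Str → ℕ → ℕ → Bool
  flags σ n i = not (halts (n + i) σ (n + i))

  flags-shift : ∀ σ n i → flags σ (suc n) i ≡ flags σ n (suc i)
  flags-shift σ n i = cong (λ k → not (halts k σ k)) (sym (+-suc n i))

  flags-antitone : ∀ {S R} → S ⊂ R → ∀ n j → flags R n j ≡ true → flags S n j ≡ true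
  flags-antitone {S} {R} S⊂R n j unflaggedR with halts (n + j) S (n + j) in hS
  ... | false = refl
  ... | true rewrite halts-mono _ S R _ S⊂R hS with () ← unflaggedR

  search-just : ∀ p s f {t} → search p s f ≡ just t → p t ≡ true × t ≤ s + f
  search-just p s zero    e with p s in ps
  search-just p s zero    refl | true = ps , m≤m+n s 0
  search-just p s (suc f) e with p s in ps
  search-just p s (suc f) refl | true = ps , m≤m+n s (suc f)
  search-just p s (suc f) {t} e | false with search-just p (suc s) f e
  ... | pt , t≤ = pt , subst (t ≤_) (sym (+-suc s f)) t≤

  search-nothing : ∀ p s f → search p s f ≡ nothing → p (s + f) ≡ false
  search-nothing p s zero    e with p s in ps
  ... | false rewrite +-identityʳ s = ps
  search-nothing p s (suc f) e with p s in ps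
  ... | false rewrite +-suc s f = search-nothing p (suc s) f e

  search-hit : ∀ p s f → p s ≡ true → search p s f ≡ just s
  search-hit p s zero    ps rewrite ps = refl
  search-hit p s (suc f) ps rewrite ps = refl

  search-extend : ∀ p p′ s f f′ {t} → f ≤ f′ → (∀ u → u ≤ s + f → p u ≡ p′ u) →
                  search p s f ≡ just t → search p′ s f′ ≡ just t
  search-extend p p′ s zero f′ _ agree e with p s in ps
  search-extend p p′ s zero f′ _ agree refl | true =
    search-hit p′ s f′ (trans (sym (agree s (m≤m+n s 0))) ps)
  search-extend p p′ s (suc f) f′ _ agree e with p s in ps
  search-extend p p′ s (suc f) f′ _ agree refl | true =
    search-hit p′ s f′ (trans (sym (agree s (m≤m+n s _))) ps)
  search-extend p p′ s (suc f) (suc f′) (s≤s f≤f′) agree e | false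
    rewrite trans (sym (agree s (m≤m+n s _))) ps =
    search-extend p p′ (suc s) f f′ f≤f′
      (λ u u≤ → agree u (subst (u ≤_) (sym (+-suc s f)) u≤)) e

  μhalt-bound : ∀ σ n {t} → μhalt σ n ≡ just t → t ≤ length σ
  μhalt-bound σ n e = proj₂ (search-just _ 0 (length σ) e)

  μhalt-halts : ∀ σ n {t} → μhalt σ n ≡ just t → halts n σ n ≡ true
  μhalt-halts σ n {t} e = halts-take n t σ n (proj₁ (search-just _ 0 (length σ) e))

  μhalt-diverges : ∀ σ n → μhalt σ n ≡ nothing → halts n σ n ≡ false
  μhalt-diverges σ n e = subst (λ τ → halts n τ n ≡ false) (take-all (length σ) σ ≤-refl)
                           (search-nothing _ 0 (length σ) e)

  μhalt-extend : ∀ S x δ n {t} → μhalt S n ≡ just t → μhalt (S ++ x ∷ δ) n ≡ just t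
  μhalt-extend S x δ n e =
    search-extend _ _ 0 (length S) (length (S ++ x ∷ δ)) S≤R
      (λ u u≤ → cong (λ τ → halts n τ n) (sym (take-++-≤ u S (x ∷ δ) u≤))) e
    where
      S≤R : length S ≤ length (S ++ x ∷ δ)
      S≤R rewrite length-++ S {x ∷ δ} = m≤m+n _ _

  next-grows : ∀ σ n p → suc p ≤ nextT σ n p
  next-grows σ n p with μhalt σ n
  ... | just t  = m≤m⊔n (suc p) t
  ... | nothing = ≤-refl

  next-bounded : ∀ σ n p → p < length σ → nextT σ n p ≤ length σ
  next-bounded σ n p p<σ with μhalt σ n in e
  ... | just t  = ⊔-lub p<σ (μhalt-bound σ n e)
  ... | nothing = p<σ

  next-agree : ∀ S x δ n p → nextT S n p ≡ nextT (S ++ x ∷ δ) n p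
                             ⊎ (halts n S n ≡ false × halts n (S ++ x ∷ δ) n ≡ true)
  next-agree S x δ n p with μhalt S n in eS | μhalt (S ++ x ∷ δ) n in eR
  ... | just t  | just t′  =
    inj₁ (cong (suc p ⊔_) (just-injective (trans (sym (μhalt-extend S x δ n eS)) eR)))
  ... | just t  | nothing  with () ← trans (sym (μhalt-extend S x δ n eS)) eR
  ... | nothing | nothing  = inj₁ refl
  ... | nothing | just t′  = inj₂ (μhalt-diverges S n eS , μhalt-halts (S ++ x ∷ δ) n eR)

  go-emit : ∀ σ f n p → nextT σ n p ≤ length σ →
            go σ (suc f) n p ≡ take (nextT σ n p) σ ∷ go σ f (suc n) (nextT σ n p)
  go-emit σ f n p within rewrite Equivalence.to T-≡ (≤⇒≤ᵇ within) = refl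

  go-stop : ∀ σ f n p → length σ < nextT σ n p → go σ (suc f) n p ≡ []
  go-stop σ f n p beyond with nextT σ n p ≤ᵇ length σ in e
  ... | false = refl
  ... | true  = ⊥-elim (<⇒≱ beyond (≤ᵇ⇒≤ _ _ (Equivalence.from T-≡ e)))

  flags-zero : ∀ σ n → flags σ n 0 ≡ not (halts n σ n)
  flags-zero σ n = cong (λ k → not (halts k σ k)) (+-identityʳ n)

  fuel-step : ∀ {l} f p q → l < suc f + p → suc p ≤ q → l < f + q
  fuel-step f p q l< p<q = <-≤-trans l< (subst (_≤ f + q) (+-suc f p) (+-monoʳ-≤ f p<q))

  module Extension (S : Str) (x : ℕ) (δ : Str) where
    R : Str
    R = S ++ x ∷ δ

    S<R : length S < length R
    S<R rewrite length-++ S {x ∷ δ} | +-suc (length S) (length δ) = s≤s (m≤m+n _ _)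

    -- Invariant: p = t_{n-1} ≤ |S|, and the fuels f, f′ exceed |S| - p, |R| - p.
    jump-overtakes : ∀ f f′ n p → length S < f + p → length R < f′ + p → p ≤ length S →
                     Overtakes (flags S n) (flags R n) (go S f n p) (go R f′ n p)
    jump-overtakes zero    _        n p S< _  p≤S = ⊥-elim (<⇒≱ S< p≤S)
    jump-overtakes (suc f) zero     n p _  R< p≤S = ⊥-elim (<⇒≱ R< (≤-trans p≤S (<⇒≤ S<R)))
    jump-overtakes (suc f) (suc f′) n p S< R< p≤S
      rewrite go-emit R f′ n p (next-bounded R n p (≤-<-trans p≤S S<R))
      with next-agree S x δ n p
    ... | inj₂ (divergesS , haltsR) =
      overtakes [] (go S (suc f) n p) _ _ refl refl
        (inj₂ (trans (flags-zero S n) (cong not divergesS) , trans (flags-zero R n) (cong not haltsR)))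
    ... | inj₁ same with nextT S n p ≤? length S
    ...   | no  beyond = overtakes [] [] _ _ (go-stop S f n p (≰⇒> beyond)) refl (inj₁ refl)
    ...   | yes within
      rewrite go-emit S f n p within | same
            | take-++-≤ (nextT R n p) S (x ∷ δ) within =
      overtakes-∷ (take (nextT R n p) S) (flags-shift S n) (flags-shift R n)
        (jump-overtakes f f′ (suc n) (nextT R n p)
          (fuel-step f p _ S< (next-grows R n p))
          (fuel-step f′ p _ R< (next-grows R n p))
          within)

  h-as-hList : ∀ a τ → h (a ∷ τ) ≡ hList (flags (a ∷ τ) 0) [] (J (a ∷ τ))
  h-as-hList a τ = let σ = a ∷ τ in
    filter-hList (λ i → not (halts i σ i)) (λ k → k) [] (J σ) (J σ) refl (λ _ → refl)

  h-antitone : ∀ {_≺_ : Str → Str → Set} S x δ →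
               KBOrder._<ω_ _≺_ (h (S ++ x ∷ δ)) (h S)
  h-antitone {_≺_} [] x δ rewrite h-as-hList x δ = below-empty _ (J (x ∷ δ))
    where open KBOrder _≺_
  h-antitone {_≺_} S@(s ∷ S′) x δ rewrite h-as-hList s S′ | h-as-hList s (S′ ++ x ∷ δ) =
    overtaken-below (flags-antitone (x , δ , refl) 0)
      (jump-overtakes (length S) (length R) 0 1 (m<m+n _ 0<1) (m<m+n _ 0<1) (s≤s z≤n))
    where
      open KBOrder _≺_
      open Extension S x δ
      0<1 : 0 < 1
      0<1 = s≤s z≤n

-- Lemma 4.11.  Monotonicity holds for all strings and any order on the
-- components.
lemma4p11 : (code : Str → ℕ) → IsCoding code →
            (halts : ℕ → Str → ℕ → Bool) → IsHalting halts →
            (T : Str → Set) → IsTree T →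
            ∀ ρ σ → T ρ → T σ → σ ⊂ ρ →
            Jump._<ω[_]_ halts (Jump.h halts ρ) code (Jump.h halts σ)
lemma4p11 _ _ halts isHalting _ _ _ σ _ _ (x , δ , refl) =
  Halting.h-antitone halts isHalting σ x δ
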